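{- Let $\Gamma=\{(m,n)\in\mathbb{Z}\times\mathbb{Z}: n\geq m\geq 2\}$ and let $f:\Gamma\to\mathbb{Z}$ be a function such that $f(m,n)=(m-1)f(m,n-1)+m\,f(m-1,n-1)$ for all $n>m\geq 3$, and $f(2,n)=1$ for all $n\geq 2$ and $f(m,m)=m!-1$ for all $m\geq 2$. Then for all $(m,n)\in\Gamma$, \[ f(m,n)=\sum_{\alpha=1}^{m-1}(-1)^{m+\alpha+1}\binom{m}{\alpha+1}\alpha^n. \] -}

module Defs where

open import Data.Nat using (ℕ; zero; suc)
open import Data.Integer using (ℤ; 0ℤ; _+_)

∑-range : ℕ → ℕ → (ℕ → ℤ) → ℤ
∑-range a zero    g = 0ℤ
∑-range a (suc k) g = g a + ∑-range (suc a) k g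

sumFrom1To : ℕ → (ℕ → ℤ) → ℤ
sumFrom1To u g = ∑-range 1 u g

-- The right-hand side g(m, n) satisfies the recurrence termwise for every m ≥ 2,
-- because α C(m, α+1) = (m−1) C(m, α+1) − m C(m−1, α+1) (the extra summand α = m−1
-- of g(m−1, ·) vanishes). As the recurrence and the boundary values determine f on Γ
-- by induction on n, it remains to check g(2, n) = 1 and g(m, m) = m! − 1. The column
-- n = 0 is a telescoping alternating binomial sum, g(m, 0) = (−1)^m (m−1); from it
-- the recurrence gives g(m, n) = (−1)^(m+n+1) for 1 ≤ n < m, and then the diagonal.
module Submission where

open import Defs
open import Data.Nat using (ℕ; _≤_; _<_; _∸_; suc; _!) renaming (_+_ to _+ℕ_)
open import Data.Nat.Combinatorics using (_C_)
open import Data.Integer using (ℤ; +_; _+_; _-_; _*_; _^_; -1ℤ; 1ℤ)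
open import Relation.Binary.PropositionalEquality using (_≡_)

open import Algebra.Properties.CommutativeSemigroup using (interchange)
open import Data.Nat using (zero; z≤n; s≤s) renaming (_*_ to _*ℕ_)
import Data.Nat.Properties as ℕ
open import Data.Nat.Combinatorics using (nC1≡n; k>n⇒nCk≡0; nCk+nC[k+1]≡[n+1]C[k+1])
import Data.Nat.Tactic.RingSolver as ℕ-Solver
open import Data.Integer using (0ℤ)
open import Data.Integer.Properties
  using ( +-assoc; +-identityˡ; +-identityʳ; +-inverseʳ; +-commutativeSemigroup
        ; *-identityˡ; *-zeroˡ; *-zeroʳ; *-distribˡ-+; ^-zeroˡ; pos-+; pos-*)
open import Data.Integer.Tactic.RingSolver using (solve; solve-∀)
open import Data.List using (_∷_; [])
open import Data.Sum using (inj₁; inj₂)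
open import Relation.Binary.PropositionalEquality
  using (refl; sym; trans; cong; cong₂; module ≡-Reasoning)

∑-range-cong : ∀ a k {g h : ℕ → ℤ} → (∀ i → g i ≡ h i) → ∑-range a k g ≡ ∑-range a k h
∑-range-cong a zero    g≗h = refl
∑-range-cong a (suc k) g≗h = cong₂ _+_ (g≗h a) (∑-range-cong (suc a) k g≗h)

∑-range-distrib-+ : ∀ a k (g h : ℕ → ℤ) →
                    ∑-range a k (λ i → g i + h i) ≡ ∑-range a k g + ∑-range a k h
∑-range-distrib-+ a zero    g h = refl
∑-range-distrib-+ a (suc k) g h = begin
  g a + h a + ∑-range (suc a) k (λ i → g i + h i)
    ≡⟨ cong (_+_ (g a + h a)) (∑-range-distrib-+ (suc a) k g h) ⟩
  g a + h a + (∑-range (suc a) k g + ∑-range (suc a) k h)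
    ≡⟨ interchange +-commutativeSemigroup (g a) (h a) _ _ ⟩
  g a + ∑-range (suc a) k g + (h a + ∑-range (suc a) k h) ∎
  where open ≡-Reasoning

*-distribˡ-∑-range : ∀ a k c (g : ℕ → ℤ) → c * ∑-range a k g ≡ ∑-range a k (λ i → c * g i)
*-distribˡ-∑-range a zero    c g = *-zeroʳ c
*-distribˡ-∑-range a (suc k) c g =
  trans (*-distribˡ-+ c (g a) _) (cong (_+_ (c * g a)) (*-distribˡ-∑-range (suc a) k c g))

∑-range-last : ∀ a k (g : ℕ → ℤ) → ∑-range a (suc k) g ≡ ∑-range a k g + g (a +ℕ k)
∑-range-last a zero    g =
  trans (+-identityʳ (g a)) (trans (cong g (sym (ℕ.+-identityʳ a))) (sym (+-identityˡ _)))
∑-range-last a (suc k) g = begin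
  g a + ∑-range (suc a) (suc k) g             ≡⟨ cong (_+_ (g a)) (∑-range-last (suc a) k g) ⟩
  g a + (∑-range (suc a) k g + g (suc a +ℕ k)) ≡⟨ sym (+-assoc (g a) _ _) ⟩
  g a + ∑-range (suc a) k g + g (suc a +ℕ k)  ≡⟨ cong (λ i → g a + ∑-range (suc a) k g + g i) (sym (ℕ.+-suc a k)) ⟩
  g a + ∑-range (suc a) k g + g (a +ℕ suc k)  ∎
  where open ≡-Reasoning

k*nCk+[1+k]*nC[1+k]≡n*nCk : ∀ n k → k *ℕ (n C k) +ℕ suc k *ℕ (n C suc k) ≡ n *ℕ (n C k)
k*nCk+[1+k]*nC[1+k]≡n*nCk n zero =
  trans (ℕ.+-identityʳ (n C 1)) (trans (nC1≡n n) (sym (ℕ.*-identityʳ n)))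
k*nCk+[1+k]*nC[1+k]≡n*nCk zero (suc k) =
  cong₂ _+ℕ_ (ℕ.*-zeroʳ (suc k)) (ℕ.*-zeroʳ (suc (suc k)))
k*nCk+[1+k]*nC[1+k]≡n*nCk (suc n) (suc k) = begin
  suc k *ℕ (suc n C suc k) +ℕ suc (suc k) *ℕ (suc n C suc (suc k))
    ≡⟨ cong₂ (λ x y → suc k *ℕ x +ℕ suc (suc k) *ℕ y) (sym (pascal k)) (sym (pascal (suc k))) ⟩
  suc k *ℕ (n C k +ℕ n C suc k) +ℕ suc (suc k) *ℕ (n C suc k +ℕ n C suc (suc k))
    ≡⟨ step (k*nCk+[1+k]*nC[1+k]≡n*nCk n k) (k*nCk+[1+k]*nC[1+k]≡n*nCk n (suc k)) ⟩
  suc n *ℕ (n C k +ℕ n C suc k)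
    ≡⟨ cong (suc n *ℕ_) (pascal k) ⟩
  suc n *ℕ (suc n C suc k) ∎
  where
  open ≡-Reasoning
  pascal : ∀ i → n C i +ℕ n C suc i ≡ suc n C suc i
  pascal = nCk+nC[k+1]≡[n+1]C[k+1] n
  step : ∀ {a b c} → k *ℕ a +ℕ suc k *ℕ b ≡ n *ℕ a → suc k *ℕ b +ℕ suc (suc k) *ℕ c ≡ n *ℕ b →
         suc k *ℕ (a +ℕ b) +ℕ suc (suc k) *ℕ (b +ℕ c) ≡ suc n *ℕ (a +ℕ b)
  step {a} {b} {c} eqa eqb = begin
    suc k *ℕ (a +ℕ b) +ℕ suc (suc k) *ℕ (b +ℕ c)
      ≡⟨ ℕ-Solver.solve (k ∷ a ∷ b ∷ c ∷ []) ⟩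
    (k *ℕ a +ℕ suc k *ℕ b) +ℕ a +ℕ (suc k *ℕ b +ℕ suc (suc k) *ℕ c) +ℕ b
      ≡⟨ cong₂ (λ x y → x +ℕ a +ℕ y +ℕ b) eqa eqb ⟩
    n *ℕ a +ℕ a +ℕ n *ℕ b +ℕ b
      ≡⟨ ℕ-Solver.solve (n ∷ a ∷ b ∷ []) ⟩
    suc n *ℕ (a +ℕ b) ∎

[1+n]*nC[1+k]+k*[1+n]C[1+k]≡n*[1+n]C[1+k] : ∀ n k →
  suc n *ℕ (n C suc k) +ℕ k *ℕ (suc n C suc k) ≡ n *ℕ (suc n C suc k)
[1+n]*nC[1+k]+k*[1+n]C[1+k]≡n*[1+n]C[1+k] n k = begin
  suc n *ℕ (n C suc k) +ℕ k *ℕ (suc n C suc k)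
    ≡⟨ cong (λ x → suc n *ℕ (n C suc k) +ℕ k *ℕ x) (sym pascal) ⟩
  suc n *ℕ (n C suc k) +ℕ k *ℕ (n C k +ℕ n C suc k)
    ≡⟨ step (k*nCk+[1+k]*nC[1+k]≡n*nCk n k) ⟩
  n *ℕ (n C k +ℕ n C suc k)
    ≡⟨ cong (n *ℕ_) pascal ⟩
  n *ℕ (suc n C suc k) ∎
  where
  open ≡-Reasoning
  pascal : n C k +ℕ n C suc k ≡ suc n C suc k
  pascal = nCk+nC[k+1]≡[n+1]C[k+1] n k
  step : ∀ {a b} → k *ℕ a +ℕ suc k *ℕ b ≡ n *ℕ a → suc n *ℕ b +ℕ k *ℕ (a +ℕ b) ≡ n *ℕ (a +ℕ b)
  step {a} {b} eq = begin
    suc n *ℕ b +ℕ k *ℕ (a +ℕ b) ≡⟨ ℕ-Solver.solve (n ∷ k ∷ a ∷ b ∷ []) ⟩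
    n *ℕ b +ℕ (k *ℕ a +ℕ suc k *ℕ b) ≡⟨ cong (n *ℕ b +ℕ_) eq ⟩
    n *ℕ b +ℕ n *ℕ a ≡⟨ ℕ-Solver.solve (n ∷ a ∷ b ∷ []) ⟩
    n *ℕ (a +ℕ b) ∎

closedFormTerm : ℕ → ℕ → ℕ → ℤ
closedFormTerm m n α = -1ℤ ^ (m +ℕ α +ℕ 1) * + (m C suc α) * (+ α) ^ n

closedForm : ℕ → ℕ → ℤ
closedForm m n = sumFrom1To (m ∸ 1) (closedFormTerm m n)

closedFormTerm-vanishes : ∀ m n → closedFormTerm m n m ≡ 0ℤ
closedFormTerm-vanishes m n = begin
  σ * + (m C suc m) * p ≡⟨ cong (λ c → σ * + c * p) (k>n⇒nCk≡0 (ℕ.n<1+n m)) ⟩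
  σ * 0ℤ * p            ≡⟨ cong (_* p) (*-zeroʳ σ) ⟩
  0ℤ * p                ≡⟨ *-zeroˡ p ⟩
  0ℤ                    ∎
  where
  open ≡-Reasoning
  σ p : ℤ
  σ = -1ℤ ^ (m +ℕ m +ℕ 1)
  p = (+ m) ^ n

∑-range-1-m≡closedForm : ∀ m n → ∑-range 1 m (closedFormTerm m n) ≡ closedForm m n
∑-range-1-m≡closedForm zero    n = refl
∑-range-1-m≡closedForm (suc k) n = begin
  ∑-range 1 (suc k) (closedFormTerm (suc k) n)
    ≡⟨ ∑-range-last 1 k (closedFormTerm (suc k) n) ⟩
  closedForm (suc k) n + closedFormTerm (suc k) n (suc k)
    ≡⟨ cong (_+_ (closedForm (suc k) n)) (closedFormTerm-vanishes (suc k) n) ⟩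
  closedForm (suc k) n + 0ℤ
    ≡⟨ +-identityʳ _ ⟩
  closedForm (suc k) n ∎
  where open ≡-Reasoning

-- The sign of closedFormTerm (2 + k) reduces to -1ℤ times that of closedFormTerm (1 + k).
closedFormTerm-rec : ∀ k n α →
  closedFormTerm (suc (suc k)) (suc n) α ≡
  + suc k * closedFormTerm (suc (suc k)) n α + + suc (suc k) * closedFormTerm (suc k) n α
closedFormTerm-rec k n α =
  rearrange (-1ℤ ^ (suc k +ℕ α +ℕ 1)) ((+ α) ^ n) (+ α) (+ X) (+ Y) (+ suc k) (+ suc (suc k)) key
  where
  X Y : ℕ
  X = suc (suc k) C suc α
  Y = suc k C suc α
  key : + suc (suc k) * + Y + + α * + X ≡ + suc k * + X
  key = begin
    + suc (suc k) * + Y + + α * + X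
      ≡⟨ sym (cong₂ _+_ (pos-* (suc (suc k)) Y) (pos-* α X)) ⟩
    + (suc (suc k) *ℕ Y) + + (α *ℕ X)
      ≡⟨ sym (pos-+ (suc (suc k) *ℕ Y) (α *ℕ X)) ⟩
    + (suc (suc k) *ℕ Y +ℕ α *ℕ X)
      ≡⟨ cong +_ ([1+n]*nC[1+k]+k*[1+n]C[1+k]≡n*[1+n]C[1+k] (suc k) α) ⟩
    + (suc k *ℕ X)
      ≡⟨ pos-* (suc k) X ⟩
    + suc k * + X ∎
    where open ≡-Reasoning
  rearrange : ∀ σ p a x y c c' → c' * y + a * x ≡ c * x →
              -1ℤ * σ * x * (a * p) ≡ c * (-1ℤ * σ * x * p) + c' * (σ * y * p)
  rearrange σ p a x y c c' eq = begin
    -1ℤ * σ * x * (a * p)                       ≡⟨ solve (σ ∷ p ∷ a ∷ x ∷ y ∷ c' ∷ []) ⟩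
    σ * p * (c' * y) - σ * p * (c' * y + a * x) ≡⟨ cong (λ t → σ * p * (c' * y) - σ * p * t) eq ⟩
    σ * p * (c' * y) - σ * p * (c * x)          ≡⟨ solve (σ ∷ p ∷ x ∷ y ∷ c ∷ c' ∷ []) ⟩
    c * (-1ℤ * σ * x * p) + c' * (σ * y * p)    ∎
    where open ≡-Reasoning

closedForm-rec : ∀ k n →
  closedForm (suc (suc k)) (suc n) ≡
  + suc k * closedForm (suc (suc k)) n + + suc (suc k) * closedForm (suc k) n
closedForm-rec k n = begin
  ∑-range 1 (suc k) (closedFormTerm (suc (suc k)) (suc n))
    ≡⟨ ∑-range-cong 1 (suc k) (closedFormTerm-rec k n) ⟩
  ∑-range 1 (suc k) (λ α → c * T α + c' * T' α)
    ≡⟨ ∑-range-distrib-+ 1 (suc k) (λ α → c * T α) (λ α → c' * T' α) ⟩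
  ∑-range 1 (suc k) (λ α → c * T α) + ∑-range 1 (suc k) (λ α → c' * T' α)
    ≡⟨ sym (cong₂ _+_ (*-distribˡ-∑-range 1 (suc k) c T) (*-distribˡ-∑-range 1 (suc k) c' T')) ⟩
  c * closedForm (suc (suc k)) n + c' * ∑-range 1 (suc k) T'
    ≡⟨ cong (λ s → c * closedForm (suc (suc k)) n + c' * s) (∑-range-1-m≡closedForm (suc k) n) ⟩
  c * closedForm (suc (suc k)) n + c' * closedForm (suc k) n ∎
  where
  open ≡-Reasoning
  c c' : ℤ
  c  = + suc k
  c' = + suc (suc k)
  T T' : ℕ → ℤ
  T  = closedFormTerm (suc (suc k)) n
  T' = closedFormTerm (suc k) n

∑-range-closedFormTerm-0 : ∀ q k →
  ∑-range 1 k (closedFormTerm (suc q) 0) ≡ -1ℤ ^ suc q * + q - -1ℤ ^ (k +ℕ suc q) * + (q C suc k)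
∑-range-closedFormTerm-0 q zero = begin
  0ℤ                      ≡⟨ sym (+-inverseʳ (τ * + q)) ⟩
  τ * + q - τ * + q       ≡⟨ cong (λ c → τ * + q - τ * + c) (sym (nC1≡n q)) ⟩
  τ * + q - τ * + (q C 1) ∎
  where
  open ≡-Reasoning
  τ : ℤ
  τ = -1ℤ ^ suc q
∑-range-closedFormTerm-0 q (suc k) = begin
  ∑-range 1 (suc k) (closedFormTerm (suc q) 0)
    ≡⟨ ∑-range-last 1 k (closedFormTerm (suc q) 0) ⟩
  ∑-range 1 k (closedFormTerm (suc q) 0) + closedFormTerm (suc q) 0 (suc k)
    ≡⟨ cong₂ _+_ (∑-range-closedFormTerm-0 q k) lastTerm ⟩
  τ * + q - σ * + a + -1ℤ * (-1ℤ * σ) * (+ a + + b) * 1ℤ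
    ≡⟨ telescope τ σ (+ q) (+ a) (+ b) ⟩
  τ * + q - -1ℤ * σ * + b ∎
  where
  open ≡-Reasoning
  τ σ : ℤ
  τ = -1ℤ ^ suc q
  σ = -1ℤ ^ (k +ℕ suc q)
  a b : ℕ
  a = q C suc k
  b = q C suc (suc k)
  exponent : suc q +ℕ suc k +ℕ 1 ≡ suc (suc (k +ℕ suc q))
  exponent = ℕ-Solver.solve (q ∷ k ∷ [])
  pascal : + (suc q C suc (suc k)) ≡ + a + + b
  pascal = trans (cong +_ (sym (nCk+nC[k+1]≡[n+1]C[k+1] q (suc k)))) (pos-+ a b)
  lastTerm : closedFormTerm (suc q) 0 (suc k) ≡ -1ℤ * (-1ℤ * σ) * (+ a + + b) * 1ℤ
  lastTerm = cong₂ (λ e c → -1ℤ ^ e * c * 1ℤ) exponent pascal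
  telescope : ∀ τ σ x y z → τ * x - σ * y + -1ℤ * (-1ℤ * σ) * (y + z) * 1ℤ ≡ τ * x - -1ℤ * σ * z
  telescope = solve-∀

closedForm-0 : ∀ q → closedForm (suc q) 0 ≡ -1ℤ ^ suc q * + q
closedForm-0 q = begin
  closedForm (suc q) 0            ≡⟨ ∑-range-closedFormTerm-0 q q ⟩
  τ * + q - σ * + (q C suc q)     ≡⟨ cong (λ c → τ * + q - σ * + c) (k>n⇒nCk≡0 (ℕ.n<1+n q)) ⟩
  τ * + q - σ * 0ℤ                ≡⟨ cong (λ c → τ * + q - c) (*-zeroʳ σ) ⟩
  τ * + q + 0ℤ                    ≡⟨ +-identityʳ _ ⟩
  τ * + q                         ∎
  where
  open ≡-Reasoning
  τ σ : ℤ
  τ = -1ℤ ^ suc q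
  σ = -1ℤ ^ (q +ℕ suc q)

closedForm-belowDiagonal : ∀ n j → closedForm (suc (suc (n +ℕ j))) (suc n) ≡ -1ℤ ^ j
closedForm-belowDiagonal zero j = begin
  closedForm (suc (suc j)) 1
    ≡⟨ closedForm-rec j 0 ⟩
  + suc j * closedForm (suc (suc j)) 0 + + suc (suc j) * closedForm (suc j) 0
    ≡⟨ cong₂ (λ x y → + suc j * x + + suc (suc j) * y) (closedForm-0 (suc j)) (closedForm-0 j) ⟩
  + suc j * (-1ℤ * (-1ℤ * σ) * + suc j) + + suc (suc j) * (-1ℤ * σ * + j)
    ≡⟨ cong₂ (λ c c' → c * (-1ℤ * (-1ℤ * σ) * c) + c' * (-1ℤ * σ * + j)) (pos-+ 1 j) (pos-+ 2 j) ⟩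
  (1ℤ + + j) * (-1ℤ * (-1ℤ * σ) * (1ℤ + + j)) + (+ 2 + + j) * (-1ℤ * σ * + j)
    ≡⟨ square-difference σ (+ j) ⟩
  σ ∎
  where
  open ≡-Reasoning
  σ : ℤ
  σ = -1ℤ ^ j
  square-difference : ∀ σ x →
    (1ℤ + x) * (-1ℤ * (-1ℤ * σ) * (1ℤ + x)) + (+ 2 + x) * (-1ℤ * σ * x) ≡ σ
  square-difference = solve-∀
closedForm-belowDiagonal (suc n) j = begin
  closedForm (suc (suc k)) (suc (suc n))
    ≡⟨ closedForm-rec k (suc n) ⟩
  + suc k * closedForm (suc (suc k)) (suc n) + + suc (suc k) * closedForm (suc k) (suc n)
    ≡⟨ cong₂ (λ x y → + suc k * x + + suc (suc k) * y) longerRow (closedForm-belowDiagonal n j) ⟩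
  + suc k * (-1ℤ * σ) + + suc (suc k) * σ
    ≡⟨ cong (λ c → + suc k * (-1ℤ * σ) + c * σ) (pos-+ 1 (suc k)) ⟩
  + suc k * (-1ℤ * σ) + (1ℤ + + suc k) * σ
    ≡⟨ cancel σ (+ suc k) ⟩
  σ ∎
  where
  open ≡-Reasoning
  k : ℕ
  k = suc (n +ℕ j)
  σ : ℤ
  σ = -1ℤ ^ j
  longerRow : closedForm (suc (suc k)) (suc n) ≡ -1ℤ * σ
  longerRow = trans (cong (λ i → closedForm (suc (suc i)) (suc n)) (sym (ℕ.+-suc n j)))
                    (closedForm-belowDiagonal n (suc j))
  cancel : ∀ σ c → c * (-1ℤ * σ) + (1ℤ + c) * σ ≡ σ
  cancel = solve-∀

closedForm-diagonal : ∀ p → closedForm (suc p) (suc p) ≡ + (suc p !) - 1ℤ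
closedForm-diagonal zero    = refl
closedForm-diagonal (suc q) = begin
  closedForm (suc (suc q)) (suc (suc q))
    ≡⟨ closedForm-rec q (suc q) ⟩
  + suc q * closedForm (suc (suc q)) (suc q) + + suc (suc q) * closedForm (suc q) (suc q)
    ≡⟨ cong₂ (λ x y → + suc q * x + + suc (suc q) * y) subDiagonal (closedForm-diagonal q) ⟩
  + suc q * 1ℤ + + suc (suc q) * (F - 1ℤ)
    ≡⟨ cong (λ c → + suc q * 1ℤ + c * (F - 1ℤ)) (pos-+ 1 (suc q)) ⟩
  + suc q * 1ℤ + (1ℤ + + suc q) * (F - 1ℤ)
    ≡⟨ collect (+ suc q) F ⟩
  (1ℤ + + suc q) * F - 1ℤ
    ≡⟨ cong (λ c → c * F - 1ℤ) (sym (pos-+ 1 (suc q))) ⟩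
  + suc (suc q) * F - 1ℤ
    ≡⟨ cong (_- 1ℤ) (sym (pos-* (suc (suc q)) (suc q !))) ⟩
  + (suc (suc q) !) - 1ℤ ∎
  where
  open ≡-Reasoning
  F : ℤ
  F = + (suc q !)
  subDiagonal : closedForm (suc (suc q)) (suc q) ≡ 1ℤ
  subDiagonal = trans (cong (λ i → closedForm (suc (suc i)) (suc q)) (sym (ℕ.+-identityʳ q)))
                      (closedForm-belowDiagonal q 0)
  collect : ∀ c F → c * 1ℤ + (1ℤ + c) * (F - 1ℤ) ≡ (1ℤ + c) * F - 1ℤ
  collect = solve-∀

closedForm-2 : ∀ n → closedForm 2 n ≡ 1ℤ
closedForm-2 n = begin
  1ℤ * 1ℤ ^ n + 0ℤ ≡⟨ +-identityʳ _ ⟩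
  1ℤ * 1ℤ ^ n      ≡⟨ *-identityˡ _ ⟩
  1ℤ ^ n           ≡⟨ ^-zeroˡ n ⟩
  1ℤ               ∎
  where open ≡-Reasoning

record IsSolution (f : ℕ → ℕ → ℤ) : Set where
  field
    recurrence : ∀ m n → 3 ≤ m → m < n → f m n ≡ + (m ∸ 1) * f m (n ∸ 1) + + m * f (m ∸ 1) (n ∸ 1)
    row-2      : ∀ n → 2 ≤ n → f 2 n ≡ 1ℤ
    diagonal   : ∀ m → 2 ≤ m → f m m ≡ + (m !) - 1ℤ

solutions-agree : ∀ {f g} → IsSolution f → IsSolution g →
                  ∀ n m → 2 ≤ m → m ≤ n → f m n ≡ g m n
solutions-agree F G n 1 (s≤s ()) _
solutions-agree F G n 2 _ 2≤n = trans (F.row-2 n 2≤n) (sym (G.row-2 n 2≤n))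
  where module F = IsSolution F; module G = IsSolution G
solutions-agree F G n (suc (suc (suc k))) 2≤m m≤n with ℕ.m≤n⇒m<n∨m≡n m≤n
... | inj₂ refl = trans (F.diagonal n 2≤m) (sym (G.diagonal n 2≤m))
  where module F = IsSolution F; module G = IsSolution G
solutions-agree {f} {g} F G (suc n) m@(suc (suc (suc k))) 2≤m _ | inj₁ (s≤s m≤n) = begin
  f m (suc n)                                     ≡⟨ F.recurrence m (suc n) 3≤m (s≤s m≤n) ⟩
  + suc (suc k) * f m n + + m * f (suc (suc k)) n ≡⟨ cong₂ (λ x y → + suc (suc k) * x + + m * y) IH IH′ ⟩
  + suc (suc k) * g m n + + m * g (suc (suc k)) n ≡⟨ sym (G.recurrence m (suc n) 3≤m (s≤s m≤n)) ⟩
  g m (suc n)                                     ∎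
  where
  open ≡-Reasoning
  module F = IsSolution F
  module G = IsSolution G
  3≤m : 3 ≤ m
  3≤m = s≤s (s≤s (s≤s z≤n))
  IH : f m n ≡ g m n
  IH = solutions-agree F G n m 2≤m m≤n
  IH′ : f (suc (suc k)) n ≡ g (suc (suc k)) n
  IH′ = solutions-agree F G n (suc (suc k)) (s≤s (s≤s z≤n)) (ℕ.<⇒≤ m≤n)

closedForm-isSolution : IsSolution closedForm
closedForm-isSolution = record
  { recurrence = λ { _ _ (s≤s (s≤s (s≤s {n = k} z≤n))) (s≤s {n = n} _) → closedForm-rec (suc k) n }
  ; row-2      = λ n _ → closedForm-2 n
  ; diagonal   = λ { _ (s≤s {n = p} _) → closedForm-diagonal p }
  }

proposition4p3 : (f : ℕ → ℕ → ℤ)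
    → (∀ m n → 3 ≤ m → m < n → f m n ≡ (+ (m ∸ 1)) * f m (n ∸ 1) + (+ m) * f (m ∸ 1) (n ∸ 1))
    → (∀ n → 2 ≤ n → f 2 n ≡ 1ℤ)
    → (∀ m → 2 ≤ m → f m m ≡ (+ (m !)) - 1ℤ)
    → ∀ m n → 2 ≤ m → m ≤ n
    → f m n ≡ sumFrom1To (m ∸ 1) (λ α → (-1ℤ ^ (m +ℕ α +ℕ 1)) * (+ (m C (suc α))) * ((+ α) ^ n))
proposition4p3 f recurrence row-2 diagonal m n 2≤m m≤n =
  solutions-agree (record { recurrence = recurrence ; row-2 = row-2 ; diagonal = diagonal })
                  closedForm-isSolution n m 2≤m m≤n
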